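{- Let $p$ be an odd prime. Then the edge set of the complete graph $K_{p^2}$ can be partitioned into $(p^2-1)/4$ subgraphs, each isomorphic to $C_p \square C_p$.
   Context: $C_n$ denotes the cycle graph on $n$ vertices and $P_n$ the path graph on $n$ vertices. For graphs $G=(V,E)$ and $G'=(V',E')$, the Cartesian product $G \square G'$ has vertex set $V \times V'$, with $(v,v')$ and $(w,w')$ adjacent iff either $\{v,w\}\in E$ and $v'=w'$, or $v=w$ and $\{v',w'\}\in E'$. A partition of $K_m$ into subgraphs means a collection of subgraphs of $K_m$ whose edge sets are pairwise disjoint and together cover all edges of $K_m$. -}

module Defs where

open import Level using (0ℓ)
open import Data.Nat using (ℕ; zero; suc)
open import Data.Fin using (Fin; toℕ)
open import Data.Product using (_×_; _,_; ∃; ∃₂; Σ-syntax)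
open import Data.Sum using (_⊎_)
open import Relation.Binary.PropositionalEquality using (_≡_; _≢_)
open import Function.Definitions using (Injective)

Graph : Set → Set₁
Graph V = V → V → Set

SuccStep : (n : ℕ) → Fin n → Fin n → Set
SuccStep n i j = (suc (toℕ i) ≡ toℕ j) ⊎ ((suc (toℕ i) ≡ n) × (toℕ j ≡ 0))

Cycle : (n : ℕ) → Graph (Fin n)
Cycle n i j = SuccStep n i j ⊎ SuccStep n j i

Complete : (m : ℕ) → Graph (Fin m)
Complete m u v = u ≢ v

infixr 7 _□_
_□_ : {V W : Set} → Graph V → Graph W → Graph (V × W)
(G □ H) (v , w) (v' , w') = (G v v' × w ≡ w') ⊎ (v ≡ v' × H w w')

-- A subgraph of K_m isomorphic to G is (up to the choice of isomorphism)
-- the image of G under an injective vertex map f : V → Fin m.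
-- Its edges are the images of the edges of G.
IsoCopyEdge : {V : Set} {m : ℕ} → Graph V → (V → Fin m) → Fin m → Fin m → Set
IsoCopyEdge {V} G f u v = ∃₂ λ (a b : V) → G a b × f a ≡ u × f b ≡ v

PartitionIntoCopies : {V : Set} (m k : ℕ) → Graph V → (Fin k → V → Fin m) → Set
PartitionIntoCopies {V} m k G F =
  ((i : Fin k) → Injective _≡_ _≡_ (F i)) ×
  ((u v : Fin m) → Complete m u v →
     ∃ λ (i : Fin k) → IsoCopyEdge G (F i) u v ×
       ((j : Fin k) → IsoCopyEdge G (F j) u v → j ≡ i))

{-# OPTIONS --safe #-}
module Submission where

-- Write p = 2q + 1 and identify the vertices of K_{p²} with 𝔽ₚ². Let v(ℓ) = (1, ℓ) for ℓ < p and
-- v(p) = (0, 1); consecutive v(ℓ), v(ℓ + 1) have determinant 1. For k ≤ q and 1 ≤ t ≤ q the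
-- linear map sending the unit vectors to t·v(2k) and t·v(2k + 1) is therefore a bijection, so
-- it embeds C_p □ C_p, and the image edges are the pairs whose difference is ±t·v(2k) or
-- ±t·v(2k + 1). Every nonzero vector of 𝔽ₚ² is ±t·v(ℓ) for a unique sign, t ≤ q and ℓ ≤ p, so
-- no edge lies in two copies. A count finishes the proof: the q(q + 1) copies have 4p² oriented
-- edges each, p²(p² − 1) in total, which is the number of ordered pairs of distinct vertices.

open import Defs
open import Data.Bool using (Bool; true; false)
open import Data.Empty using (⊥-elim)
open import Data.Fin as Fin using (Fin; zero; suc; toℕ; fromℕ; inject₁; punchOut; combine)
open import Data.Fin.Patterns using (0F; 1F)
open import Data.Fin.Properties using (*↔×; 2↔Bool)
import Data.Fin.Properties as Finₚ
open import Data.Fin.Relation.Unary.Top using (view; ‵fromℕ; ‵inject₁)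
open import Data.Nat as ℕ using (ℕ; zero; suc; _≤_; _<_; _∸_; _/_; z≤n; s≤s; nonTrivial⇒n>1)
import Data.Nat.Divisibility as ℕᵈ
open import Data.Nat.Primality using (Prime; euclidsLemma; prime⇒nonTrivial)
import Data.Nat.Properties as ℕₚ
open import Data.Product using (_×_; _,_; proj₁; proj₂; ∃)
open import Data.Product.Function.NonDependent.Propositional using (_×-↔_)
open import Data.Sum using (inj₁; inj₂; [_,_]′)
open import Function.Base using (_∘_)
open import Function.Bundles using (_↔_; Inverse; Injection)
open import Function.Definitions using (Injective)
open import Function.Properties.Inverse using (↔-refl; ↔-sym; ↔-trans; ↔⇒↣)
open import Relation.Binary.PropositionalEquality
open import Relation.Nullary using (¬_; yes; no)

injective⇒surjective : ∀ {n} {f : Fin n → Fin n} → Injective _≡_ _≡_ f →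
                       ∀ y → ∃ λ x → f x ≡ y
injective⇒surjective {suc n} {f} f-inj y with Finₚ.any? (λ x → f x Fin.≟ y)
... | yes found = found
... | no ¬found = ⊥-elim (Finₚ.<⇒notInjective (ℕₚ.n<1+n n) g-inj)
  where
  y≢f : ∀ x → y ≢ f x
  y≢f x y≡fx = ¬found (x , sym y≡fx)

  g : Fin (suc n) → Fin n
  g x = punchOut (y≢f x)

  g-inj : Injective _≡_ _≡_ g
  g-inj gx≡gx′ = f-inj (Finₚ.punchOut-injective (y≢f _) (y≢f _) gx≡gx′)

module _ {A B : Set} {n : ℕ} (A↔ : A ↔ Fin n) (B↔ : B ↔ Fin n) where

  injective⇒surjective-↔ : ∀ {f : A → B} → Injective _≡_ _≡_ f →
                           ∀ b → ∃ λ a → f a ≡ b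
  injective⇒surjective-↔ {f} f-inj b =
    let i , gi≡b = injective⇒surjective g-inj (Inverse.to B↔ b)
    in Inverse.from A↔ i , to-injective B↔ gi≡b
    where
    to-injective : ∀ {C D : Set} (C↔D : C ↔ D) → Injective _≡_ _≡_ (Inverse.to C↔D)
    to-injective C↔D = Injection.injective (↔⇒↣ C↔D)

    g : Fin n → Fin n
    g i = Inverse.to B↔ (f (Inverse.from A↔ i))

    g-inj : Injective _≡_ _≡_ g
    g-inj e = to-injective (↔-sym A↔) (f-inj (to-injective B↔ e))

odd⇒suc-double : ∀ n → ¬ (2 ℕᵈ.∣ n) → ∃ λ h → n ≡ suc (h ℕ.+ h)
odd⇒suc-double zero          odd = ⊥-elim (odd (2 ℕᵈ.∣0))
odd⇒suc-double (suc zero)    _   = 0 , refl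
odd⇒suc-double (suc (suc n)) odd =
  let h , n≡1+2h = odd⇒suc-double n (odd ∘ ℕᵈ.∣m∣n⇒∣m+n (ℕᵈ.∣-refl {2}))
  in suc h , cong (2 ℕ.+_) (trans n≡1+2h (sym (ℕₚ.+-suc h h)))

distinctPair : ∀ {n} {u v : Fin (suc n)} → u ≢ v → Fin (suc n) × Fin n
distinctPair {u = u} u≢v = u , punchOut u≢v

distinctPair-injective : ∀ {n} {u v x y : Fin (suc n)} (u≢v : u ≢ v) (x≢y : x ≢ y) →
                         distinctPair u≢v ≡ distinctPair x≢y → u ≡ x × v ≡ y
distinctPair-injective u≢v x≢y eq with refl ← cong proj₁ eq =
  refl , Finₚ.punchOut-injective u≢v x≢y (cong proj₂ eq)

module IntegerPlane where
  open import Data.Integer using (ℤ; _+_; _-_; _*_; 0ℤ; 1ℤ; -1ℤ)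
  open import Data.Integer.Tactic.RingSolver using (solve-∀)

  ℤ² : Set
  ℤ² = ℤ × ℤ

  infixr 7 _·_
  infixl 6 _⊕_

  _·_ : ℤ → ℤ² → ℤ²
  k · (x , y) = k * x , k * y

  _⊕_ : ℤ² → ℤ² → ℤ²
  (x , y) ⊕ (u , v) = x + u , y + v

  unit : Fin 2 → ℤ²
  unit 0F = 1ℤ , 0ℤ
  unit 1F = 0ℤ , 1ℤ

  sign : Bool → ℤ
  sign true  = 1ℤ
  sign false = -1ℤ

  det : ℤ² → ℤ² → ℤ
  det (a , b) (c , d) = a * d - c * b

  sign-involutive : ∀ s x → sign s * (sign s * x) ≡ x
  sign-involutive true  = solve-∀
  sign-involutive false = solve-∀

  lincomb : (Fin 2 → ℤ²) → ℤ² → ℤ²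
  lincomb w (x , y) = x · w 0F ⊕ y · w 1F

  lincomb-unit : ∀ w c k x → lincomb w (k · unit c ⊕ x) ≡ k · w c ⊕ lincomb w x
  lincomb-unit w 0F k (x , y) = cong₂ _,_ (shift k x y _ _) (shift k x y _ _)
    where
    shift : ∀ k x y a b → (k * 1ℤ + x) * a + (k * 0ℤ + y) * b ≡ k * a + (x * a + y * b)
    shift = solve-∀
  lincomb-unit w 1F k (x , y) = cong₂ _,_ (shift k x y _ _) (shift k x y _ _)
    where
    shift : ∀ k x y a b → (k * 0ℤ + x) * a + (k * 1ℤ + y) * b ≡ k * b + (x * a + y * b)
    shift = solve-∀

  lincomb-scale : ∀ k w x → lincomb (λ c → k · w c) x ≡ k · lincomb w x
  lincomb-scale k w (x , y) = cong₂ _,_ (pull k x y _ _) (pull k x y _ _)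
    where
    pull : ∀ k x y a b → x * (k * a) + y * (k * b) ≡ k * (x * a + y * b)
    pull = solve-∀

module Congruence (m : ℕ) where
  open import Data.Integer
    using (ℤ; +_; -_; _+_; _-_; _*_; ∣_∣; 0ℤ; 1ℤ; -1ℤ)
  import Data.Integer.Properties as ℤₚ
  open import Data.Integer.Divisibility.Signed
    using (_∣_; divides; ∣⇒∣ᵤ; ∣m∣n⇒∣m+n; ∣m∣n⇒∣m-n; ∣m⇒∣-m; ∣m⇒∣m*n; ∣n⇒∣m*n)
  open import Data.Integer.Tactic.RingSolver using (solve-∀)
  open import Relation.Binary.Bundles using (Setoid)
  open import Relation.Binary.Structures using (IsEquivalence)
  import Relation.Binary.Reasoning.Setoid as SetoidReasoning
  open import Data.Product.Relation.Binary.Pointwise.NonDependent using (Pointwise; ×-setoid)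
  open import Data.Integer.DivMod using (_%ℕ_; _/ℕ_; n%ℕd<d; a≡a%ℕn+[a/ℕn]*n)
  open IntegerPlane

  -- A record rather than a synonym for  + m ∣ x - y , so that x and y can be inferred.
  infix 4 _≈_
  record _≈_ (x y : ℤ) : Set where
    constructor ∣⇒≈
    field ≈⇒∣ : + m ∣ x - y
  open _≈_ public

  private
    ≈-by : ∀ {x y z} → z ≡ x - y → + m ∣ z → x ≈ y
    ≈-by z≡x-y m∣z = ∣⇒≈ (subst (+ m ∣_) z≡x-y m∣z)

  ≈-reflexive : ∀ {x y} → x ≡ y → x ≈ y
  ≈-reflexive {x} refl = ∣⇒≈ (divides 0ℤ (x-x≡0*k x (+ m)))
    where
    x-x≡0*k : ∀ x k → x - x ≡ 0ℤ * k
    x-x≡0*k = solve-∀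

  ≈-refl : ∀ {x} → x ≈ x
  ≈-refl = ≈-reflexive refl

  ≈-sym : ∀ {x y} → x ≈ y → y ≈ x
  ≈-sym {x} {y} (∣⇒≈ m∣x-y) = ≈-by (-[x-y]≡y-x x y) (∣m⇒∣-m m∣x-y)
    where
    -[x-y]≡y-x : ∀ x y → - (x - y) ≡ y - x
    -[x-y]≡y-x = solve-∀

  ≈-trans : ∀ {x y z} → x ≈ y → y ≈ z → x ≈ z
  ≈-trans {x} {y} {z} (∣⇒≈ m∣x-y) (∣⇒≈ m∣y-z) =
    ≈-by (telescope x y z) (∣m∣n⇒∣m+n m∣x-y m∣y-z)
    where
    telescope : ∀ x y z → (x - y) + (y - z) ≡ x - z
    telescope = solve-∀

  ≈-isEquivalence : IsEquivalence _≈_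
  ≈-isEquivalence = record { refl = ≈-refl ; sym = ≈-sym ; trans = ≈-trans }

  ≈-setoid : Setoid _ _
  ≈-setoid = record { isEquivalence = ≈-isEquivalence }

  +-cong : ∀ {x y u v} → x ≈ y → u ≈ v → x + u ≈ y + v
  +-cong {x} {y} {u} {v} (∣⇒≈ m∣x-y) (∣⇒≈ m∣u-v) =
    ≈-by (interchange x y u v) (∣m∣n⇒∣m+n m∣x-y m∣u-v)
    where
    interchange : ∀ x y u v → (x - y) + (u - v) ≡ (x + u) - (y + v)
    interchange = solve-∀

  *-congˡ : ∀ k {x y} → x ≈ y → k * x ≈ k * y
  *-congˡ k {x} {y} (∣⇒≈ m∣x-y) = ≈-by (distrib k x y) (∣n⇒∣m*n k m∣x-y)
    where
    distrib : ∀ k x y → k * (x - y) ≡ k * x - k * y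
    distrib = solve-∀

  *-congʳ : ∀ k {x y} → x ≈ y → x * k ≈ y * k
  *-congʳ k {x} {y} (∣⇒≈ m∣x-y) = ≈-by (distrib k x y) (∣m⇒∣m*n k m∣x-y)
    where
    distrib : ∀ k x y → (x - y) * k ≡ x * k - y * k
    distrib = solve-∀

  +-cancelʳ : ∀ {x y a b} → x + a ≈ y + b → a ≈ b → x ≈ y
  +-cancelʳ {x} {y} {a} {b} (∣⇒≈ m∣x+a-[y+b]) (∣⇒≈ m∣a-b) =
    ≈-by (cancel x y a b) (∣m∣n⇒∣m-n m∣x+a-[y+b] m∣a-b)
    where
    cancel : ∀ x y a b → ((x + a) - (y + b)) - (a - b) ≡ x - y
    cancel = solve-∀

  m≈0 : + m ≈ 0ℤ
  m≈0 = ∣⇒≈ (divides 1ℤ (m-0≡1*m (+ m)))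
    where
    m-0≡1*m : ∀ k → k - 0ℤ ≡ 1ℤ * k
    m-0≡1*m = solve-∀

  ≈0⇒≡0 : ∀ {x} → x ≈ 0ℤ → ∣ x ∣ < m → x ≡ 0ℤ
  ≈0⇒≡0 {x} (∣⇒≈ m∣x-0) ∣x∣<m =
    ℤₚ.∣i∣≡0⇒i≡0 (small-multiple (∣⇒∣ᵤ (subst (+ m ∣_) (ℤₚ.+-identityʳ x) m∣x-0))
                                 ∣x∣<m)
    where
    small-multiple : ∀ {d} → m ℕᵈ.∣ d → d < m → d ≡ 0
    small-multiple {zero}  _    _   = refl
    small-multiple {suc _} m∣d d<m = ⊥-elim (ℕᵈ.>⇒∤ d<m m∣d)

  ≈⇒≡ : ∀ {x y} → x < m → y < m → + x ≈ + y → x ≡ y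
  ≈⇒≡ {x} {y} x<m y<m x≈y = ℤₚ.+-injective (ℤₚ.i-j≡0⇒i≡j (+ x) (+ y) x-y≡0)
    where
    ∣x-y∣<m : ∣ + x - + y ∣ < m
    ∣x-y∣<m = subst (_< m) (sym (cong ∣_∣ (ℤₚ.m-n≡m⊖n x y)))
                (ℕₚ.≤-<-trans (ℤₚ.∣m⊝n∣≤m⊔n x y) (ℕₚ.⊔-lub x<m y<m))

    x-y≡0 : + x - + y ≡ 0ℤ
    x-y≡0 = ≈0⇒≡0 (≈-by (sym (ℤₚ.+-identityʳ (+ x - + y))) (≈⇒∣ x≈y)) ∣x-y∣<m

  toℕ-≈⇒≡ : ∀ {i j : Fin m} → + toℕ i ≈ + toℕ j → i ≡ j
  toℕ-≈⇒≡ {i} {j} i≈j = Finₚ.toℕ-injective (≈⇒≡ (Finₚ.toℕ<n i) (Finₚ.toℕ<n j) i≈j)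

  ≉0 : ∀ {t} → 0 < t → t < m → ¬ (+ t ≈ 0ℤ)
  ≉0 0<t t<m t≈0 = ℕₚ.<⇒≢ 0<t (sym (ℤₚ.+-injective (≈0⇒≡0 t≈0 t<m)))

  module _ .{{_ : ℕ.NonZero m}} where
    residue : ℤ → Fin m
    residue x = Fin.fromℕ< (n%ℕd<d x m)

    ≈-residue : ∀ x → x ≈ + toℕ (residue x)
    ≈-residue x = ∣⇒≈ (divides (x /ℕ m) (begin
      x - + toℕ (residue x)
        ≡⟨ cong (λ r → x - + r) (Finₚ.toℕ-fromℕ< (n%ℕd<d x m)) ⟩
      x - + (x %ℕ m)
        ≡⟨ cong (_- + (x %ℕ m)) (a≡a%ℕn+[a/ℕn]*n x m) ⟩
      (+ (x %ℕ m) + (x /ℕ m) * + m) - + (x %ℕ m)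
        ≡⟨ cancel (+ (x %ℕ m)) (x /ℕ m * + m) ⟩
      (x /ℕ m) * + m
        ∎))
      where
      open ≡-Reasoning
      cancel : ∀ r k → (r + k) - r ≡ k
      cancel = solve-∀

    residue-≈ : ∀ {x y} → residue x ≡ residue y → x ≈ y
    residue-≈ {x} {y} e = begin
      x                   ≈⟨ ≈-residue x ⟩
      + toℕ (residue x)   ≡⟨ cong (λ r → + toℕ r) e ⟩
      + toℕ (residue y)   ≈⟨ ≈-residue y ⟨
      y                   ∎
      where open SetoidReasoning ≈-setoid

  sign-cancel : ∀ s {x y} → sign s * x ≈ sign s * y → x ≈ y
  sign-cancel s {x} {y} e = begin
    x                     ≡⟨ sign-involutive s x ⟨
    sign s * (sign s * x) ≈⟨ *-congˡ (sign s) e ⟩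
    sign s * (sign s * y) ≡⟨ sign-involutive s y ⟩
    y                     ∎
    where open SetoidReasoning ≈-setoid

  private
    opposite-signs : ∀ {t u} → 0 < t → t ℕ.+ u < m → ¬ (sign true * + t ≈ sign false * + u)
    opposite-signs {t} {u} 0<t t+u<m e = ≉0 (ℕₚ.<-≤-trans 0<t (ℕₚ.m≤m+n t u)) t+u<m (begin
      + (t ℕ.+ u)        ≡⟨ ℤₚ.pos-+ t u ⟩
      + t + + u          ≡⟨ cong (_+ + u) (ℤₚ.*-identityˡ (+ t)) ⟨
      1ℤ * + t + + u     ≈⟨ +-cong e ≈-refl ⟩
      -1ℤ * + u + + u    ≡⟨ cancel (+ u) ⟩
      0ℤ                 ∎)
      where
      open SetoidReasoning ≈-setoid
      cancel : ∀ u → -1ℤ * u + u ≡ 0ℤ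
      cancel = solve-∀

    same-sign : ∀ s {t u} → t ℕ.+ u < m → sign s * + t ≈ sign s * + u → t ≡ u
    same-sign s {t} {u} t+u<m e =
      ≈⇒≡ (ℕₚ.≤-<-trans (ℕₚ.m≤m+n t u) t+u<m) (ℕₚ.≤-<-trans (ℕₚ.m≤n+m u t) t+u<m)
          (sign-cancel s e)

  signed≉0 : ∀ s {t} → 0 < t → t < m → ¬ (sign s * + t ≈ 0ℤ)
  signed≉0 s 0<t t<m e =
    ≉0 0<t t<m (sign-cancel s (≈-trans e (≈-reflexive (sym (ℤₚ.*-zeroʳ (sign s))))))

  sign-unique : ∀ s r {t u} → 0 < t → 0 < u → t ℕ.+ u < m →
                sign s * + t ≈ sign r * + u → s ≡ r × t ≡ u
  sign-unique true  true  _   _   t+u<m e = refl , same-sign true t+u<m e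
  sign-unique false false _   _   t+u<m e = refl , same-sign false t+u<m e
  sign-unique true  false 0<t _   t+u<m e = ⊥-elim (opposite-signs 0<t t+u<m e)
  sign-unique false true  {t} {u} _ 0<u t+u<m e =
    ⊥-elim (opposite-signs 0<u (subst (_< m) (ℕₚ.+-comm t u) t+u<m) (≈-sym e))

  infix 4 _≈²_
  _≈²_ : ℤ² → ℤ² → Set
  _≈²_ = Pointwise _≈_ _≈_

  ≈²-setoid : Setoid _ _
  ≈²-setoid = ×-setoid ≈-setoid ≈-setoid

  ⊕-cancelʳ : ∀ {x y a b} → x ⊕ a ≈² y ⊕ b → a ≈² b → x ≈² y
  ⊕-cancelʳ (e₁ , e₂) (f₁ , f₂) = +-cancelʳ e₁ f₁ , +-cancelʳ e₂ f₂

  lincomb-cong : ∀ w {x y} → x ≈² y → lincomb w x ≈² lincomb w y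
  lincomb-cong w (e₁ , e₂) =
    +-cong (*-congʳ _ e₁) (*-congʳ _ e₂) , +-cong (*-congʳ _ e₁) (*-congʳ _ e₂)

  lincomb-injective : ∀ w {x y} → det (w 0F) (w 1F) ≡ 1ℤ → lincomb w x ≈² lincomb w y → x ≈² y
  lincomb-injective w {x₁ , x₂} {y₁ , y₂} det≡1 (∣⇒≈ m∣d₁ , ∣⇒≈ m∣d₂) =
    ≈-by (unimodular (cramer₁ x₁ y₁ x₂ y₂ a₁ a₂ b₁ b₂))
         (∣m∣n⇒∣m-n (∣n⇒∣m*n b₂ m∣d₁) (∣n⇒∣m*n b₁ m∣d₂)) ,
    ≈-by (unimodular (cramer₂ x₁ y₁ x₂ y₂ a₁ a₂ b₁ b₂))
         (∣m∣n⇒∣m-n (∣n⇒∣m*n a₁ m∣d₂) (∣n⇒∣m*n a₂ m∣d₁))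
    where
    a₁ a₂ b₁ b₂ : ℤ
    a₁ = proj₁ (w 0F)
    a₂ = proj₂ (w 0F)
    b₁ = proj₁ (w 1F)
    b₂ = proj₂ (w 1F)

    unimodular : ∀ {z d} → z ≡ d * det (w 0F) (w 1F) → z ≡ d
    unimodular {d = d} z≡d*det = trans z≡d*det (trans (cong (d *_) det≡1) (ℤₚ.*-identityʳ d))

    cramer₁ : ∀ x₁ y₁ x₂ y₂ a₁ a₂ b₁ b₂ →
      b₂ * ((x₁ * a₁ + x₂ * b₁) - (y₁ * a₁ + y₂ * b₁))
        - b₁ * ((x₁ * a₂ + x₂ * b₂) - (y₁ * a₂ + y₂ * b₂))
        ≡ (x₁ - y₁) * (a₁ * b₂ - b₁ * a₂)
    cramer₁ = solve-∀

    cramer₂ : ∀ x₁ y₁ x₂ y₂ a₁ a₂ b₁ b₂ →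
      a₁ * ((x₁ * a₂ + x₂ * b₂) - (y₁ * a₂ + y₂ * b₂))
        - a₂ * ((x₁ * a₁ + x₂ * b₁) - (y₁ * a₁ + y₂ * b₁))
        ≡ (x₂ - y₂) * (a₁ * b₂ - b₁ * a₂)
    cramer₂ = solve-∀

module PrimeCongruence (p : ℕ) (p-prime : Prime p) where
  open import Data.Integer using (+_; _-_; _*_; ∣_∣)
  import Data.Integer.Properties as ℤₚ
  open import Data.Integer.Divisibility.Signed using (_∣_; ∣⇒∣ᵤ; ∣ᵤ⇒∣)
  open import Data.Integer.Tactic.RingSolver using (solve-∀)
  open IntegerPlane
  open Congruence p

  *-cancelˡ : ∀ {t x y} → 0 < t → t < p → + t * x ≈ + t * y → x ≈ y
  *-cancelˡ {t@(suc _)} {x} {y} _ t<p (∣⇒≈ p∣tx-ty) =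
    [ (λ p∣t → ⊥-elim (ℕᵈ.>⇒∤ t<p p∣t)) , (λ p∣∣x-y∣ → ∣⇒≈ (∣ᵤ⇒∣ p∣∣x-y∣)) ]′
      (euclidsLemma t ∣ x - y ∣ p-prime p∣t*∣x-y∣)
    where
    factor : ∀ t x y → t * x - t * y ≡ t * (x - y)
    factor = solve-∀

    p∣t*∣x-y∣ : p ℕᵈ.∣ t ℕ.* ∣ x - y ∣
    p∣t*∣x-y∣ = subst (p ℕᵈ.∣_) (ℤₚ.abs-* (+ t) (x - y))
                  (∣⇒∣ᵤ (subst (+ p ∣_) (factor (+ t) x y) p∣tx-ty))

  ·-cancelˡ : ∀ {t x y} → 0 < t → t < p → + t · x ≈² + t · y → x ≈² y
  ·-cancelˡ {t} {x₁ , x₂} {y₁ , y₂} 0<t t<p (e₁ , e₂) =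
    *-cancelˡ {t} {x₁} {y₁} 0<t t<p e₁ , *-cancelˡ {t} {x₂} {y₂} 0<t t<p e₂

successor : ∀ {n} (i : Fin (suc n)) → ∃ (SuccStep (suc n) i)
successor i with view i
... | ‵fromℕ     = zero , inj₂ (cong suc (Finₚ.toℕ-fromℕ _) , refl)
... | ‵inject₁ j = suc j , inj₁ (cong suc (Finₚ.toℕ-inject₁ j))

predecessor : ∀ {n} (j : Fin (suc n)) → ∃ λ i → SuccStep (suc n) i j
predecessor {n} zero = fromℕ n , inj₂ (cong suc (Finₚ.toℕ-fromℕ n) , refl)
predecessor (suc j)  = inject₁ j , inj₁ (cong suc (Finₚ.toℕ-inject₁ j))

neighbour : ∀ {n} → Fin (suc n) → Bool → Fin (suc n)
neighbour i true  = proj₁ (successor i)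
neighbour i false = proj₁ (predecessor i)

neighbour-edge : ∀ {n} (i : Fin (suc n)) s → Cycle (suc n) i (neighbour i s)
neighbour-edge i true  = inj₁ (proj₂ (successor i))
neighbour-edge i false = inj₂ (proj₂ (predecessor i))

orientation : ∀ {n} {i j : Fin n} → Cycle n i j → Bool
orientation (inj₁ _) = true
orientation (inj₂ _) = false

orientation-neighbour : ∀ {n} (i : Fin (suc n)) s → orientation (neighbour-edge i s) ≡ s
orientation-neighbour i true  = refl
orientation-neighbour i false = refl

SuccStep-irreflexive : ∀ {n} {i : Fin n} → 1 < n → ¬ SuccStep n i i
SuccStep-irreflexive _   (inj₁ 1+i≡i)        = ℕₚ.1+n≢n 1+i≡i
SuccStep-irreflexive 1<n (inj₂ (1+i≡n , i≡0)) = ℕₚ.<⇒≢ 1<n (trans (cong suc (sym i≡0)) 1+i≡n)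

Cycle-irreflexive : ∀ {n} {i : Fin n} → 1 < n → ¬ Cycle n i i
Cycle-irreflexive 1<n (inj₁ i→i) = SuccStep-irreflexive 1<n i→i
Cycle-irreflexive 1<n (inj₂ i→i) = SuccStep-irreflexive 1<n i→i

Torus : (n : ℕ) → Graph (Fin n × Fin n)
Torus n = Cycle n □ Cycle n

Direction : Set
Direction = Fin 2 × Bool

direction : ∀ {n} {a b : Fin n × Fin n} → Torus n a b → Direction
direction (inj₁ (h , _)) = 0F , orientation h
direction (inj₂ (_ , h)) = 1F , orientation h

step : ∀ {n} → Fin (suc n) × Fin (suc n) → Direction → Fin (suc n) × Fin (suc n)
step (x , y) (0F , s) = neighbour x s , y
step (x , y) (1F , s) = x , neighbour y s

step-edge : ∀ {n} a d → Torus (suc n) a (step a d)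
step-edge (x , y) (0F , s) = inj₁ (neighbour-edge x s , refl)
step-edge (x , y) (1F , s) = inj₂ (refl , neighbour-edge y s)

direction-step : ∀ {n} a d → direction (step-edge {n} a d) ≡ d
direction-step (x , y) (0F , s) = cong (0F ,_) (orientation-neighbour x s)
direction-step (x , y) (1F , s) = cong (1F ,_) (orientation-neighbour y s)

Torus-irreflexive : ∀ {n} {a : Fin n × Fin n} → 1 < n → ¬ Torus n a a
Torus-irreflexive 1<n (inj₁ (h , _)) = Cycle-irreflexive 1<n h
Torus-irreflexive 1<n (inj₂ (_ , h)) = Cycle-irreflexive 1<n h

module Displacement (n : ℕ) where
  open import Data.Integer using (+_; _+_; _*_; 0ℤ; 1ℤ)
  import Data.Integer.Properties as ℤₚ
  open import Data.Integer.Tactic.RingSolver using (solve-∀)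
  open IntegerPlane
  open Congruence n
  open import Relation.Binary.Reasoning.Setoid ≈-setoid

  position : Fin n × Fin n → ℤ²
  position (x , y) = + toℕ x , + toℕ y

  position-injective : ∀ {a b} → position a ≈² position b → a ≡ b
  position-injective (e₁ , e₂) = cong₂ _,_ (toℕ-≈⇒≡ e₁) (toℕ-≈⇒≡ e₂)

  displacement : Direction → ℤ²
  displacement (c , s) = sign s · unit c

  SuccStep-≈ : ∀ {i j} → SuccStep n i j → + toℕ j ≈ 1ℤ + + toℕ i
  SuccStep-≈ (inj₁ 1+i≡j) = ≈-reflexive (cong +_ (sym 1+i≡j))
  SuccStep-≈ {i} {j} (inj₂ (1+i≡n , j≡0)) = begin
    + toℕ j       ≡⟨ cong +_ j≡0 ⟩
    0ℤ            ≈⟨ m≈0 ⟨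
    + n           ≡⟨ cong +_ 1+i≡n ⟨
    1ℤ + + toℕ i  ∎

  Cycle-≈ : ∀ {i j} (h : Cycle n i j) → + toℕ j ≈ sign (orientation h) + + toℕ i
  Cycle-≈ (inj₁ i→j) = SuccStep-≈ i→j
  Cycle-≈ {i} {j} (inj₂ j→i) = begin
    + toℕ j                     ≡⟨ cancel (+ toℕ j) ⟨
    sign false + (1ℤ + + toℕ j) ≈⟨ +-cong (≈-refl {sign false}) (SuccStep-≈ j→i) ⟨
    sign false + + toℕ i        ∎
    where
    cancel : ∀ x → sign false + (1ℤ + x) ≡ x
    cancel = solve-∀

  private
    along : ∀ {i j} (h : Cycle n i j) → + toℕ j ≈ sign (orientation h) * 1ℤ + + toℕ i
    along h = ≈-trans (Cycle-≈ h)
                      (≈-reflexive (cong (_+ _) (sym (ℤₚ.*-identityʳ (sign (orientation h))))))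

    across : ∀ k (i : Fin n) → + toℕ i ≈ k * 0ℤ + + toℕ i
    across k i = ≈-reflexive (sym (vanish k (+ toℕ i)))
      where
      vanish : ∀ k x → k * 0ℤ + x ≡ x
      vanish = solve-∀

  Torus-≈ : ∀ {a b} (h : Torus n a b) →
            position b ≈² displacement (direction h) ⊕ position a
  Torus-≈ (inj₁ (h , refl)) = along h , across (sign (orientation h)) _
  Torus-≈ (inj₂ (refl , h)) = across (sign (orientation h)) _ , along h

module Lines (p : ℕ) (p-prime : Prime p) where
  open import Data.Integer using (+_; _+_; _-_; _*_; 0ℤ; 1ℤ)
  import Data.Integer.Properties as ℤₚ
  open import Data.Integer.Tactic.RingSolver using (solve-∀)
  open IntegerPlane
  open Congruence p
  open PrimeCongruence p p-prime

  -- One direction vector on each of the p + 1 lines through the origin of 𝔽ₚ².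
  line : ℕ → ℤ²
  line ℓ with ℓ ℕ.<? p
  ... | yes _ = 1ℤ , + ℓ
  ... | no  _ = 0ℤ , 1ℤ

  det-line-suc : ∀ {ℓ} → ℓ < p → det (line ℓ) (line (suc ℓ)) ≡ 1ℤ
  det-line-suc {ℓ} ℓ<p with ℓ ℕ.<? p | suc ℓ ℕ.<? p
  ... | no ℓ≮p | _     = ⊥-elim (ℓ≮p ℓ<p)
  ... | yes _  | yes _ =
    trans (cong (λ x → 1ℤ * x - 1ℤ * + ℓ) (ℤₚ.pos-+ 1 ℓ)) (det-consecutive (+ ℓ))
    where
    det-consecutive : ∀ x → 1ℤ * (1ℤ + x) - 1ℤ * x ≡ 1ℤ
    det-consecutive = solve-∀
  ... | yes _  | no _  = det-vertical (+ ℓ)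
    where
    det-vertical : ∀ x → 1ℤ * 1ℤ - 0ℤ * x ≡ 1ℤ
    det-vertical = solve-∀

  private
    left<p : ∀ {t u} → t ℕ.+ u < p → t < p
    left<p {t} {u} t+u<p = ℕₚ.≤-<-trans (ℕₚ.m≤m+n t u) t+u<p

    right<p : ∀ {t u} → t ℕ.+ u < p → u < p
    right<p {t} {u} t+u<p = ℕₚ.≤-<-trans (ℕₚ.m≤n+m u t) t+u<p

    times-one : ∀ s t → sign s * (t * 1ℤ) ≡ sign s * t
    times-one s t = cong (sign s *_) (ℤₚ.*-identityʳ t)

    times-zero : ∀ s t → sign s * (t * 0ℤ) ≡ 0ℤ
    times-zero s t = trans (cong (sign s *_) (ℤₚ.*-zeroʳ t)) (ℤₚ.*-zeroʳ (sign s))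

    same-coordinate : ∀ s r {t u} → 0 < t → 0 < u → t ℕ.+ u < p →
                      sign s * (+ t * 1ℤ) ≈ sign r * (+ u * 1ℤ) → s ≡ r × t ≡ u
    same-coordinate s r {t} {u} 0<t 0<u t+u<p e =
      sign-unique s r 0<t 0<u t+u<p (subst₂ _≈_ (times-one s (+ t)) (times-one r (+ u)) e)

    zero-coordinate : ∀ s r {t u} → 0 < t → t < p → ¬ (sign s * (+ t * 1ℤ) ≈ sign r * (+ u * 0ℤ))
    zero-coordinate s r {t} {u} 0<t t<p e =
      signed≉0 s 0<t t<p (subst₂ _≈_ (times-one s (+ t)) (times-zero r (+ u)) e)

    ≤∧≮⇒≡ : ∀ {ℓ} → ℓ ≤ p → ¬ ℓ < p → ℓ ≡ p
    ≤∧≮⇒≡ ℓ≤p ℓ≮p = ℕₚ.≤-antisym ℓ≤p (ℕₚ.≮⇒≥ ℓ≮p)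

  scaled-line-unique : ∀ s r {t u ℓ k} → 0 < t → 0 < u → t ℕ.+ u < p → ℓ ≤ p → k ≤ p →
                       sign s · + t · line ℓ ≈² sign r · + u · line k →
                       s ≡ r × t ≡ u × ℓ ≡ k
  scaled-line-unique s r {t} {u} {ℓ} {k} 0<t 0<u t+u<p ℓ≤p k≤p (e₁ , e₂)
    with ℓ ℕ.<? p | k ℕ.<? p
  ... | yes ℓ<p | yes k<p with refl , refl ← same-coordinate s r 0<t 0<u t+u<p e₁ =
    refl , refl , ≈⇒≡ ℓ<p k<p (*-cancelˡ 0<t (left<p t+u<p) (sign-cancel s e₂))
  ... | yes _   | no _    = ⊥-elim (zero-coordinate s r {t} {u} 0<t (left<p t+u<p) e₁)
  ... | no _    | yes _   = ⊥-elim (zero-coordinate r s {u} {t} 0<u (right<p t+u<p) (≈-sym e₁))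
  ... | no ℓ≮p  | no k≮p  with refl , refl ← same-coordinate s r 0<t 0<u t+u<p e₂ =
    refl , refl , trans (≤∧≮⇒≡ ℓ≤p ℓ≮p) (sym (≤∧≮⇒≡ k≤p k≮p))

module Decomposition (q : ℕ) (p-prime : Prime (suc (q ℕ.+ q))) where
  open import Data.Integer using (+_; 1ℤ)
  import Data.Nat.Tactic.RingSolver as ℕ-Solver
  import Data.Nat.DivMod as ℕ-DivMod
  open IntegerPlane

  p : ℕ
  p = suc (q ℕ.+ q)

  open Congruence p
  open PrimeCongruence p p-prime
  open Displacement p
  open Lines p p-prime

  Copy : Set
  Copy = Fin (suc q) × Fin q

  scale : Copy → ℕ
  scale (_ , τ) = suc (toℕ τ)

  slope : Copy → Fin 2 → ℕ
  slope (k , _) c = toℕ (combine k c)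

  generator : Copy → Fin 2 → ℤ²
  generator κ c = + scale κ · line (slope κ c)

  scale-sum : ∀ κ ν → scale κ ℕ.+ scale ν < p
  scale-sum (_ , τ) (_ , υ) = s≤s (ℕₚ.+-mono-≤ (Finₚ.toℕ<n τ) (Finₚ.toℕ<n υ))

  scale<p : ∀ κ → scale κ < p
  scale<p (_ , τ) = s≤s (ℕₚ.≤-trans (Finₚ.toℕ<n τ) (ℕₚ.m≤m+n q q))

  slope≤p : ∀ κ c → slope κ c ≤ p
  slope≤p (k , _) c = ℕₚ.≤-pred (subst (toℕ (combine k c) <_) slopes (Finₚ.toℕ<n (combine k c)))
    where
    slopes : suc q ℕ.* 2 ≡ suc p
    slopes = cong (2 ℕ.+_) (trans (ℕₚ.*-comm q 2) (cong (q ℕ.+_) (ℕₚ.+-identityʳ q)))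

  slope-suc : ∀ κ → slope κ 1F ≡ suc (slope κ 0F)
  slope-suc (k , _) = begin
    toℕ (combine k 1F)       ≡⟨ Finₚ.toℕ-combine k 1F ⟩
    2 ℕ.* toℕ k ℕ.+ 1        ≡⟨ ℕₚ.+-suc (2 ℕ.* toℕ k) 0 ⟩
    suc (2 ℕ.* toℕ k ℕ.+ 0)  ≡⟨ cong suc (Finₚ.toℕ-combine k 0F) ⟨
    suc (toℕ (combine k 0F)) ∎
    where open ≡-Reasoning

  det-generators : ∀ κ → det (line (slope κ 0F)) (line (slope κ 1F)) ≡ 1ℤ
  det-generators κ rewrite slope-suc κ = det-line-suc (subst (_≤ p) (slope-suc κ) (slope≤p κ 1F))

  Vertex : Set
  Vertex = Fin p × Fin p

  embedding : Copy → Vertex → ℤ²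
  embedding κ a = lincomb (generator κ) (position a)

  -- Opaque because unfolding it makes unification normalise residues of symbolic integers.
  opaque
    copy : Copy → Vertex → Fin (p ℕ.* p)
    copy κ a = combine (residue (proj₁ (embedding κ a))) (residue (proj₂ (embedding κ a)))

    copy-≈ : ∀ {κ ν a b} → copy κ a ≡ copy ν b → embedding κ a ≈² embedding ν b
    copy-≈ {κ} {ν} {a} {b} eq =
      let e₁ , e₂ = Finₚ.combine-injective _ _ _ _ eq in residue-≈ e₁ , residue-≈ e₂

  embedding-injective : ∀ κ {a b} → embedding κ a ≈² embedding κ b → a ≡ b
  embedding-injective κ {a} {b} e =
    position-injective (lincomb-injective lines {position a} {position b} (det-generators κ)
      (·-cancelˡ {scale κ} (s≤s z≤n) (scale<p κ) unscaled))
    where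
    lines : Fin 2 → ℤ²
    lines c = line (slope κ c)

    unscaled : + scale κ · lincomb lines (position a) ≈² + scale κ · lincomb lines (position b)
    unscaled = subst₂ _≈²_ (lincomb-scale (+ scale κ) lines (position a))
                           (lincomb-scale (+ scale κ) lines (position b)) e

  copy-injective : ∀ κ {a b} → copy κ a ≡ copy κ b → a ≡ b
  copy-injective κ {a} {b} eq = embedding-injective κ (copy-≈ {κ} {κ} {a} {b} eq)

  edgeVector : Copy → Direction → ℤ²
  edgeVector κ (c , s) = sign s · generator κ c

  embedding-edge : ∀ κ {a b} (h : Torus p a b) →
                   embedding κ b ≈² edgeVector κ (direction h) ⊕ embedding κ a
  embedding-edge κ {a} {b} h = begin
    lincomb w (position b)                                  ≈⟨ lincomb-cong w {position b} (Torus-≈ h) ⟩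
    lincomb w (displacement (direction h) ⊕ position a)     ≡⟨ lincomb-unit w c (sign s) (position a) ⟩
    edgeVector κ (direction h) ⊕ lincomb w (position a)     ∎
    where
    open import Relation.Binary.Reasoning.Setoid ≈²-setoid

    w : Fin 2 → ℤ²
    w = generator κ

    c : Fin 2
    c = proj₁ (direction h)

    s : Bool
    s = proj₂ (direction h)

  edgeVector-injective : ∀ {κ ν d e} → edgeVector κ d ≈² edgeVector ν e → κ ≡ ν × d ≡ e
  edgeVector-injective {κ@(k , τ)} {ν@(l , υ)} {c , s} {c′ , s′} eq
    with refl , t≡u , slope≡ ← scaled-line-unique s s′ (s≤s z≤n) (s≤s z≤n) (scale-sum κ ν)
                                  (slope≤p κ c) (slope≤p ν c′) eq
    with refl ← Finₚ.toℕ-injective (ℕₚ.suc-injective t≡u)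
    with refl , refl ← Finₚ.combine-injective k c l c′ (Finₚ.toℕ-injective slope≡)
    = refl , refl

  edge-determines-copy : ∀ {κ ν a b x y} (h : Torus p a b) (g : Torus p x y) →
                         copy κ a ≡ copy ν x → copy κ b ≡ copy ν y →
                         κ ≡ ν × direction h ≡ direction g
  edge-determines-copy {κ} {ν} {a} {b} {x} {y} h g a↦x b↦y =
    edgeVector-injective (⊕-cancelʳ (begin
      edgeVector κ (direction h) ⊕ embedding κ a  ≈⟨ embedding-edge κ h ⟨
      embedding κ b                               ≈⟨ copy-≈ {κ} {ν} {b} {y} b↦y ⟩
      embedding ν y                               ≈⟨ embedding-edge ν g ⟩
      edgeVector ν (direction g) ⊕ embedding ν x  ∎) (copy-≈ {κ} {ν} {a} {x} a↦x))
    where open import Relation.Binary.Reasoning.Setoid ≈²-setoid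

  Flag : Set
  Flag = Copy × Vertex × Direction

  copy-step-≢ : ∀ κ a d → copy κ a ≢ copy κ (step a d)
  copy-step-≢ κ a d eq = Torus-irreflexive (nonTrivial⇒n>1 p) loop
    where
    instance _ = prime⇒nonTrivial p-prime
    loop : Torus p a a
    loop = subst (Torus p a) (sym (copy-injective κ eq)) (step-edge a d)

  arc : Flag → Fin (p ℕ.* p) × Fin (p ℕ.* p ∸ 1)
  arc (κ , a , d) = distinctPair (copy-step-≢ κ a d)

  arc-injective : Injective _≡_ _≡_ arc
  arc-injective {κ , a , d} {ν , x , e} eq = cong₂ _,_ κ≡ν (cong₂ _,_ a≡x d≡e)
    where
    ends : copy κ a ≡ copy ν x × copy κ (step a d) ≡ copy ν (step x e)
    ends = distinctPair-injective (copy-step-≢ κ a d) (copy-step-≢ ν x e) eq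

    same : κ ≡ ν × direction (step-edge a d) ≡ direction (step-edge x e)
    same = edge-determines-copy (step-edge a d) (step-edge x e) (proj₁ ends) (proj₂ ends)

    κ≡ν : κ ≡ ν
    κ≡ν = proj₁ same

    a≡x : a ≡ x
    a≡x = copy-injective κ (trans (proj₁ ends) (cong (λ μ → copy μ x) (sym κ≡ν)))

    d≡e : d ≡ e
    d≡e = trans (sym (direction-step a d)) (trans (proj₂ same) (direction-step x e))

  -- (q + q) + (q + q) * p is the normal form of p * p ∸ 1, stated so because the solver has no ∸.
  private
    square-minus-one : ∀ q → (q ℕ.+ q) ℕ.+ (q ℕ.+ q) ℕ.* suc (q ℕ.+ q) ≡ suc q ℕ.* q ℕ.* 4
    square-minus-one = ℕ-Solver.solve-∀

    flag-count : ∀ q → let p = suc (q ℕ.+ q) in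
                 suc q ℕ.* q ℕ.* (p ℕ.* p ℕ.* 4)
                   ≡ p ℕ.* p ℕ.* ((q ℕ.+ q) ℕ.+ (q ℕ.+ q) ℕ.* p)
    flag-count = ℕ-Solver.solve-∀

  flag↔ : Flag ↔ Fin (p ℕ.* p ℕ.* (p ℕ.* p ∸ 1))
  flag↔ = subst (λ n → Flag ↔ Fin n) (flag-count q)
    (↔-sym (↔-trans *↔× (*↔× ×-↔ ↔-trans *↔× (*↔× ×-↔ direction↔))))
    where
    direction↔ : Fin 4 ↔ Direction
    direction↔ = ↔-trans (*↔× {2} {2}) (↔-refl ×-↔ 2↔Bool)

  every-arc : ∀ x → ∃ λ f → arc f ≡ x
  every-arc = injective⇒surjective-↔ flag↔ (↔-sym *↔×) arc-injective

  index↔ : Fin ((p ℕ.* p ∸ 1) / 4) ↔ Copy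
  index↔ = subst (λ n → Fin n ↔ Copy) (sym copies) *↔×
    where
    copies : (p ℕ.* p ∸ 1) / 4 ≡ suc q ℕ.* q
    copies = trans (cong (_/ 4) (square-minus-one q)) (ℕ-DivMod.m*n/n≡m (suc q ℕ.* q) 4)

  partition : ∃ λ F → PartitionIntoCopies (p ℕ.* p) ((p ℕ.* p ∸ 1) / 4) (Torus p) F
  partition = F , (λ i → copy-injective (index i)) , covered
    where
    open Inverse index↔ using (strictlyInverseˡ; strictlyInverseʳ) renaming (to to index; from to label)

    F : Fin ((p ℕ.* p ∸ 1) / 4) → Vertex → Fin (p ℕ.* p)
    F i = copy (index i)

    covered : ∀ u v → Complete (p ℕ.* p) u v →
              ∃ λ i → IsoCopyEdge (Torus p) (F i) u v ×
                      (∀ j → IsoCopyEdge (Torus p) (F j) u v → j ≡ i)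
    covered u v u≢v =
      label κ , (a , step a d , step-edge a d , trans (relabel a) a↦u , trans (relabel _) b↦v) , unique
      where
      hit : ∃ λ f → arc f ≡ distinctPair u≢v
      hit = every-arc (distinctPair u≢v)

      κ : Copy
      κ = proj₁ (proj₁ hit)

      a : Vertex
      a = proj₁ (proj₂ (proj₁ hit))

      d : Direction
      d = proj₂ (proj₂ (proj₁ hit))

      a↦u : copy κ a ≡ u
      a↦u = proj₁ (distinctPair-injective (copy-step-≢ κ a d) u≢v (proj₂ hit))

      b↦v : copy κ (step a d) ≡ v
      b↦v = proj₂ (distinctPair-injective (copy-step-≢ κ a d) u≢v (proj₂ hit))

      relabel : ∀ b → F (label κ) b ≡ copy κ b
      relabel b = cong (λ μ → copy μ b) (strictlyInverseˡ κ)

      unique : ∀ j → IsoCopyEdge (Torus p) (F j) u v → j ≡ label κ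
      unique j (x , y , g , x↦u , y↦v) =
        trans (sym (strictlyInverseʳ j)) (cong label (proj₁ (edge-determines-copy g (step-edge a d)
          (trans x↦u (sym a↦u)) (trans y↦v (sym b↦v)))))

-- Opened only here, as they would clash with the integer operators opened in the modules above.
open import Data.Nat using (_*_)
open import Data.Nat.Divisibility using (_∣_)

theorem1 : (p : ℕ) → Prime p → ¬ (2 ∣ p) →
    ∃ λ (F : Fin ((p * p ∸ 1) / 4) → Fin p × Fin p → Fin (p * p)) →
      PartitionIntoCopies (p * p) ((p * p ∸ 1) / 4) (Cycle p □ Cycle p) F
theorem1 p p-prime odd with q , refl ← odd⇒suc-double p odd = Decomposition.partition q p-prime
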